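{- Let $m \geq 2$. Then $M_1^m \not\models I^m_X A(X)$.
   Context: $\mathcal{L}_0$ has sorts $\mathsf{i}$, $\mathsf{list}$ and symbols $\mathit{nil}:\mathsf{list}$, $\mathit{cons}:\mathsf{i}\times\mathsf{list}\to\mathsf{list}$; $\mathcal{L}_A$ adds a predicate $A:\mathsf{list}\to o$. $\mathit{cons}(t_1,\dots,t_n;T)$ abbreviates $\mathit{cons}(t_1,\mathit{cons}(t_2,\dots,\mathit{cons}(t_n,T)\dots))$ ($=T$ if $n=0$). $I^m_X A(X)$ is the formula \[ \Big(\bigwedge_{i=1}^{m} \forall x_1\dots\forall x_{i-1}\, A(\mathit{cons}(x_1,\dots,x_{i-1};\mathit{nil})) \wedge \forall X\,\forall x_1\dots\forall x_m\,\big(A(X)\rightarrow A(\mathit{cons}(x_1,\dots,x_m;X))\big)\Big) \rightarrow \forall X\,A(X). \] Sequences: $\mathbb N^*$ is the set of finite sequences of natural numbers, $\varepsilon$ the empty sequence, $(n)$ a one-element sequence, $\frown$ concatenation of ordinal-indexed sequences. For $k\in\mathbb N$, $N_k=(i)_{k\le i<\omega}$, and $\mathcal N=\{w\frown N_k: w\in\mathbb N^*, k\in\mathbb N\}$. Every $N\in\mathcal N$ has a unique decomposition $N=w\frown N_k$ with $|w|$ and $k$ minimal; write $w_N$, $k_N$ for these. For $m\ge1$, the $\mathcal L_A$-structure $M_1^m$ interprets $\mathsf i$ as $\mathbb N$, $\mathsf{list}$ as $\mathbb N^*\cup\mathcal N$, $\mathit{nil}$ as $\varepsilon$, $\mathit{cons}(n,l)$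 as $(n)\frown l$, and $A$ as $\mathbb N^*\cup\{N\in\mathcal N: w_N\neq\varepsilon \text{ or } m\nmid k_N\}$. -}

module Defs where

open import Data.Nat using (ℕ; zero; suc; _+_; _≤_; _∸_)
open import Data.Nat.Divisibility using (_∣_)
open import Data.List using (List; []; _∷_; length)
open import Data.Vec using (Vec; []; _∷_)
open import Data.Product using (Σ; ∃; ∃-syntax; _×_; _,_)
open import Data.Sum using (_⊎_)
open import Data.Unit using (⊤)
open import Relation.Nullary using (¬_)
open import Relation.Binary.PropositionalEquality using (_≡_; _≢_; refl)

Seq : Set
Seq = ℕ → ℕ

Nk : ℕ → Seq
Nk k i = k + i

_⌢_ : List ℕ → Seq → Seq
([] ⌢ s) i = s i
((x ∷ w) ⌢ s) zero = x
((x ∷ w) ⌢ s) (suc i) = (w ⌢ s) i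

prefix : ℕ → Seq → Seq
prefix n s zero = n
prefix n s (suc i) = s i

Decomp : Seq → List ℕ → ℕ → Set
Decomp f w k = ∀ i → f i ≡ (w ⌢ Nk k) i

InN : Seq → Set
InN f = Σ (List ℕ) λ w → Σ ℕ λ k → Decomp f w k

MinDecomp : Seq → List ℕ → ℕ → Set
MinDecomp f w k =
  Decomp f w k
  × (∀ w' k' → Decomp f w' k' → length w ≤ length w')
  × (∀ w' k' → Decomp f w' k' → length w' ≡ length w → k ≤ k')

prefix-InN : ∀ n f → InN f → InN (prefix n f)
prefix-InN n f (w , k , d) = (n ∷ w) , k , λ { zero → refl ; (suc i) → d i }

data Lst : Set where
  fin : List ℕ → Lst
  inf : (f : Seq) → InN f → Lst

nilM : Lst
nilM = fin []

consM : ℕ → Lst → Lst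
consM n (fin l) = fin (n ∷ l)
consM n (inf f p) = inf (prefix n f) (prefix-InN n f p)

consV : ∀ {n} → Vec ℕ n → Lst → Lst
consV [] T = T
consV (x ∷ xs) T = consM x (consV xs T)

AM : ℕ → Lst → Set
AM m (fin _) = ⊤
AM m (inf f _) = ∃[ w ] ∃[ k ] (MinDecomp f w k × (w ≢ [] ⊎ ¬ (m ∣ k)))

Im : ℕ → (Lst → Set) → Set
Im m P =
  ((i : ℕ) → 1 ≤ i → i ≤ m → (xs : Vec ℕ (i ∸ 1)) → P (consV xs nilM))
  × (∀ (X : Lst) (xs : Vec ℕ m) → P X → P (consV xs X))
  → ∀ (X : Lst) → P X

-- Prepending m elements preserves A.  Finite lists are in A anyway; for an
-- infinite list X = w ⌢ N_k in A, the minimal decomposition of a list obtained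
-- by prepending m elements has nonempty prefix unless that list is some N_j,
-- in which case X = N_(j+m), so w_X = ε and k_X = j + m; then m ∤ j + m gives
-- m ∤ j.  Hence the premise of I^m holds, while N_m ∉ A since m ∣ m.
module Submission where

open import Defs
open import Data.Nat using (ℕ; _≤_)
open import Relation.Nullary using (¬_)

open import Data.Nat using (zero; suc; _+_; _∸_; z≤n; s≤s; _≟_; _≤?_)
open import Data.Nat.Properties
  using (+-identityʳ; +-suc; +-assoc; ≤-reflexive; ≤-pred; ≰⇒>; m≤n⇒m<n∨m≡n)
open import Data.Nat.Divisibility using (_∣_; ∣-refl; ∣m∣n⇒∣m+n)
open import Data.List using ([]; _∷_; _++_; length; applyUpTo)
open import Data.List.Properties using (length-applyUpTo)
open import Data.Vec using (Vec; []; _∷_; toList)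
open import Data.Product using (∃-syntax; ∃₂; _×_; _,_; proj₁)
open import Data.Sum using (_⊎_; inj₁; inj₂; [_,_])
open import Data.Unit using (tt)
open import Relation.Nullary using (yes; no; contradiction)
open import Relation.Binary.PropositionalEquality
  using (_≡_; _≢_; refl; sym; trans; cong; subst; module ≡-Reasoning)

Suffix : Seq → ℕ → ℕ → Set
Suffix g n k = ∀ i → g (n + i) ≡ Nk k i

module _ {g : Seq} where

  Suffix-head : ∀ {n k} → Suffix g n k → g n ≡ k
  Suffix-head {n} {k} t = trans (cong g (sym (+-identityʳ n))) (trans (t 0) (+-identityʳ k))

  Suffix-unique : ∀ {n j k} → Suffix g n j → Suffix g n k → j ≡ k
  Suffix-unique s t = trans (sym (Suffix-head s)) (Suffix-head t)

  Suffix-suc : ∀ {n k} → Suffix g n k → Suffix g (suc n) (suc k)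
  Suffix-suc {n} {k} t i = begin
    g (suc (n + i)) ≡⟨ cong g (sym (+-suc n i)) ⟩
    g (n + suc i)   ≡⟨ t (suc i) ⟩
    k + suc i       ≡⟨ +-suc k i ⟩
    suc k + i       ∎
    where open ≡-Reasoning

  Suffix-pred : ∀ {n} → Suffix g (suc n) (suc (g n)) → Suffix g n (g n)
  Suffix-pred {n} t zero = trans (cong g (+-identityʳ n)) (sym (+-identityʳ (g n)))
  Suffix-pred {n} t (suc i) = begin
    g (n + suc i)   ≡⟨ cong g (+-suc n i) ⟩
    g (suc (n + i)) ≡⟨ t i ⟩
    suc (g n) + i   ≡⟨ sym (+-suc (g n) i) ⟩
    g n + suc i     ∎
    where open ≡-Reasoning

  Suffix-normal : ∀ {n k} → Suffix g n k → Suffix g n (g n)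
  Suffix-normal {n} t = subst (Suffix g n) (sym (Suffix-head t)) t

  Suffix-mono : ∀ {n k p} → Suffix g n k → n ≤ p → Suffix g p (g p)
  Suffix-mono t n≤p with m≤n⇒m<n∨m≡n n≤p
  ... | inj₂ refl = Suffix-normal t
  ... | inj₁ (s≤s n≤p′) = Suffix-normal (Suffix-suc (Suffix-mono t n≤p′))

  -- Move the start down while g steps by one just before it; where this stops,
  -- an earlier suffix would force that step.
  leastSuffix : ∀ n {k} → Suffix g n k →
                ∃₂ λ s j → Suffix g s j × (∀ {p k′} → Suffix g p k′ → s ≤ p)
  leastSuffix zero {k} t = zero , k , t , λ _ → z≤n
  leastSuffix (suc n) {k} t with k ≟ suc (g n)
  ... | yes refl = leastSuffix n (Suffix-pred t)
  ... | no k≢ = suc n , k , t , least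
    where
    least : ∀ {p k′} → Suffix g p k′ → suc n ≤ p
    least {p} t′ with suc n ≤? p
    ... | yes le = le
    ... | no nle =
      contradiction (Suffix-unique t (Suffix-suc (Suffix-mono t′ (≤-pred (≰⇒> nle))))) k≢

Decomp⇒Suffix : ∀ w {g k} → Decomp g w k → Suffix g (length w) k
Decomp⇒Suffix [] d = d
Decomp⇒Suffix (_ ∷ w) d = Decomp⇒Suffix w (λ i → d (suc i))

Suffix⇒Decomp : ∀ n {g k} → Suffix g n k → Decomp g (applyUpTo g n) k
Suffix⇒Decomp zero t = t
Suffix⇒Decomp (suc n) t zero = refl
Suffix⇒Decomp (suc n) t (suc i) = Suffix⇒Decomp n t i

minDecomp : ∀ {f} → InN f → ∃₂ (MinDecomp f)
minDecomp {f} (w , _ , d) with leastSuffix {g = f} (length w) (Decomp⇒Suffix w d)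
... | s , j , t , least = applyUpTo f s , j , Suffix⇒Decomp s t , shortest , smallest
  where
  shortest : ∀ w′ k′ → Decomp f w′ k′ → length (applyUpTo f s) ≤ length w′
  shortest w′ _ d′ = subst (_≤ length w′) (sym (length-applyUpTo f s)) (least (Decomp⇒Suffix w′ d′))

  smallest : ∀ w′ k′ → Decomp f w′ k′ → length w′ ≡ length (applyUpTo f s) → j ≤ k′
  smallest w′ k′ d′ e = ≤-reflexive (Suffix-unique {g = f} t
    (subst (λ n → Suffix f n k′) (trans e (length-applyUpTo f s)) (Decomp⇒Suffix w′ d′)))

MinDecomp-Nk : ∀ {f w k j} → Decomp f [] j → MinDecomp f w k → w ≡ [] × k ≡ j
MinDecomp-Nk {f} {w = []} d (d′ , _) = refl , Suffix-unique {g = f} d′ d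
MinDecomp-Nk {w = _ ∷ _} d (_ , shortest , _) with shortest [] _ d
... | ()

InA : ℕ → Seq → Set
InA m f = ∃[ w ] ∃[ k ] (MinDecomp f w k × (w ≢ [] ⊎ ¬ (m ∣ k)))

Nk∉InA : ∀ {m k} → m ∣ k → ¬ InA m (Nk k)
Nk∉InA m∣k (w , _ , min , h) with MinDecomp-Nk {w = w} (λ _ → refl) min
... | refl , refl = [ (λ w≢[] → w≢[] refl) , (λ m∤k → m∤k m∣k) ] h

Decomp-shift : ∀ {g f n k} → (∀ i → g (n + i) ≡ f i) → Decomp g [] k → Decomp f [] (k + n)
Decomp-shift {g} {f} {n} {k} shift d i = begin
  f i           ≡⟨ sym (shift i) ⟩
  g (n + i)     ≡⟨ d (n + i) ⟩
  k + (n + i)   ≡⟨ sym (+-assoc k n i) ⟩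
  k + n + i     ∎
  where open ≡-Reasoning

InA-prepend : ∀ {m n g f} → m ∣ n → (∀ i → g (n + i) ≡ f i) → InN g → InA m f → InA m g
InA-prepend m∣n shift g∈N (w₀ , _ , minf , h) with minDecomp g∈N
... | x ∷ w , k , ming = x ∷ w , k , ming , inj₁ (λ ())
... | [] , k , ming with MinDecomp-Nk {w = w₀} (Decomp-shift shift (proj₁ ming)) minf
...   | refl , refl = [] , k , ming , inj₂ (λ m∣k →
        [ (λ w≢[] → w≢[] refl) , (λ m∤k+n → m∤k+n (∣m∣n⇒∣m+n m∣k m∣n)) ] h)

prepend : ∀ {n} → Vec ℕ n → Seq → Seq
prepend [] f = f
prepend (x ∷ xs) f = prefix x (prepend xs f)

prepend-shift : ∀ {n} (xs : Vec ℕ n) f i → prepend xs f (n + i) ≡ f i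
prepend-shift [] f i = refl
prepend-shift (_ ∷ xs) f i = prepend-shift xs f i

prepend-InN : ∀ {n} (xs : Vec ℕ n) {f} → InN f → InN (prepend xs f)
prepend-InN [] p = p
prepend-InN (x ∷ xs) p = prefix-InN x _ (prepend-InN xs p)

consV-fin : ∀ {n} (xs : Vec ℕ n) l → consV xs (fin l) ≡ fin (toList xs ++ l)
consV-fin [] l = refl
consV-fin (x ∷ xs) l = cong (consM x) (consV-fin xs l)

consV-inf : ∀ {n} (xs : Vec ℕ n) {f} (p : InN f) →
            consV xs (inf f p) ≡ inf (prepend xs f) (prepend-InN xs p)
consV-inf [] p = refl
consV-inf (x ∷ xs) p = cong (consM x) (consV-inf xs p)

AM-consV-fin : ∀ {m n} (xs : Vec ℕ n) l → AM m (consV xs (fin l))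
AM-consV-fin {m} xs l = subst (AM m) (sym (consV-fin xs l)) tt

AM-consV : ∀ {m n} → m ∣ n → (xs : Vec ℕ n) (X : Lst) → AM m X → AM m (consV xs X)
AM-consV _ xs (fin l) _ = AM-consV-fin xs l
AM-consV {m} m∣n xs (inf f p) f∈A = subst (AM m) (sym (consV-inf xs p))
  (InA-prepend m∣n (prepend-shift xs f) (prepend-InN xs p) f∈A)

lemma3p13 : (m : ℕ) → 2 ≤ m → ¬ Im m (AM m)
lemma3p13 m _ Im-holds = Nk∉InA ∣-refl (Im-holds (base , step) Nm)
  where
  Nm : Lst
  Nm = inf (Nk m) ([] , m , λ _ → refl)

  base : (i : ℕ) → 1 ≤ i → i ≤ m → (xs : Vec ℕ (i ∸ 1)) → AM m (consV xs nilM)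
  base _ _ _ xs = AM-consV-fin xs []

  step : ∀ (X : Lst) (xs : Vec ℕ m) → AM m X → AM m (consV xs X)
  step X xs = AM-consV ∣-refl xs X
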